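{- Let $M$ be a vertex-transitive map in which every vertex has degree $q$, and let $k$ be the number of orbits of the automorphism group $\Gamma(M)$ on the set of flags of $M$. Then $k$ divides $2q$.
   Context: A map is a 2-cell embedding of a finite multigraph (multiple edges allowed) on a closed surface without boundary; the connected components of the complement of the graph are the faces. The map induces a triangulation of the surface whose triangles, called flags, each have as vertices one vertex of the map, the midpoint of an edge incident to it, and the centre of a face incident to that edge. An automorphism of $M$ is an automorphism of its underlying graph that extends to a homeomorphism of the surface; $\Gamma(M)$ denotes the group of all automorphisms, which acts on the flags. $M$ is vertex-transitive if $\Gamma(M)$ acts transitively on the vertices of $M$. -}

module Defs where

open import Data.Nat using (ℕ; _*_)
open import Data.Fin using (Fin)
open import Data.List using (List; []; _∷_)
open import Data.List.Membership.Propositional using (_∈_)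
open import Data.Product using (Σ; ∃; _×_)
open import Function.Definitions using (Injective; Surjective)
open import Relation.Binary.PropositionalEquality using (_≡_; _≢_)

-- With gs a list of involutions on a finite set, this is exactly the
-- relation "y lies in the orbit of x under the group generated by gs".
data Reach {n : ℕ} (gs : List (Fin n → Fin n)) (x : Fin n) : Fin n → Set where
  here : Reach gs x x
  step : ∀ {g y} → g ∈ gs → Reach gs x y → Reach gs x (g y)

-- A map, in its standard combinatorial (flag) description: the finite set of
-- flags Fin n together with the three involutions r₀ r₁ r₂ (r_i sends a flag to
-- the unique adjacent flag differing only in its i-dimensional vertex:
-- 0 = map vertex, 1 = edge midpoint, 2 = face centre).
record Map : Set where
  field
    n        : ℕ
    r₀ r₁ r₂ : Fin n → Fin n
    r₀-inv   : ∀ x → r₀ (r₀ x) ≡ x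
    r₁-inv   : ∀ x → r₁ (r₁ x) ≡ x
    r₂-inv   : ∀ x → r₂ (r₂ x) ≡ x
    r₀-fpf   : ∀ x → r₀ x ≢ x
    r₁-fpf   : ∀ x → r₁ x ≢ x
    r₂-fpf   : ∀ x → r₂ x ≢ x
    r₀r₂-comm : ∀ x → r₀ (r₂ x) ≡ r₂ (r₀ x)
    r₀r₂-fpf  : ∀ x → r₀ (r₂ x) ≢ x
    connected : ∀ x y → Reach (r₀ ∷ r₁ ∷ r₂ ∷ []) x y
    someFlag  : Fin n

  -- Two flags belong to the same vertex iff they are in the same ⟨r₁,r₂⟩-orbit.
  SameVertex : Fin n → Fin n → Set
  SameVertex = Reach (r₁ ∷ r₂ ∷ [])

  record Automorphism : Set where
    field
      fun     : Fin n → Fin n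
      inv     : Fin n → Fin n
      inv-l   : ∀ x → inv (fun x) ≡ x
      inv-r   : ∀ x → fun (inv x) ≡ x
      comm₀   : ∀ x → fun (r₀ x) ≡ r₀ (fun x)
      comm₁   : ∀ x → fun (r₁ x) ≡ r₁ (fun x)
      comm₂   : ∀ x → fun (r₂ x) ≡ r₂ (fun x)

  open Automorphism public

  VertexTransitive : Set
  VertexTransitive = ∀ x y → Σ Automorphism λ α → SameVertex (fun α x) y

  VertexFlagCount : Fin n → ℕ → Set
  VertexFlagCount x m =
    Σ (Fin m → Fin n) λ g → Injective _≡_ _≡_ g
      × (∀ y → SameVertex x y → ∃ λ i → g i ≡ y)
      × (∀ i → SameVertex x (g i))

  -- Every vertex has degree q, i.e. is incident with exactly 2q flags
  -- (each edge-end at the vertex contributes two flags; loops count twice).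
  AllDegrees : ℕ → Set
  AllDegrees q = ∀ x → VertexFlagCount x (2 * q)

  SameFlagOrbit : Fin n → Fin n → Set
  SameFlagOrbit x y = Σ Automorphism λ α → fun α x ≡ y

  NumFlagOrbits : ℕ → Set
  NumFlagOrbits k =
    Σ (Fin n → Fin k) λ c → Surjective _≡_ _≡_ c
      × (∀ x y → (c x ≡ c y → SameFlagOrbit x y) × (SameFlagOrbit x y → c x ≡ c y))

{-# OPTIONS --safe #-}
-- Since M is connected, Γ(M) acts freely on flags. Fix a flag x₀ at a vertex v.
-- By vertex-transitivity every flag orbit j has a representative w_j at v. The
-- automorphisms fixing v are indexed by the s flags at v in the orbit of x₀
-- (their images of x₀). A flag at v in orbit j is the image of w_j under exactly
-- one automorphism, and that automorphism fixes v; so the 2q flags at v are in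
-- bijection with pairs (orbit, vertex stabiliser element), and 2q = k · s.
module Submission where

open import Defs
open import Data.Nat using (ℕ; _*_)
open import Data.Nat.Divisibility using (_∣_; divides)
open import Data.Nat.Properties using (*-comm)
open import Data.Fin using (Fin; zero; suc; _≟_)
open import Data.Fin.Properties using (*↔×)
open import Data.Fin.Permutation using (↔⇒≡)
open import Data.List using (List; []; _∷_; length; lookup; filter; allFin)
open import Data.List.Membership.Propositional using (_∈_)
open import Data.List.Membership.Propositional.Properties using (∈-lookup; ∈-filter⁺; ∈-filter⁻; ∈-allFin)
open import Data.List.Relation.Unary.All as All using ()
open import Data.List.Relation.Unary.AllPairs using (_∷_)
open import Data.List.Relation.Unary.Any using (here; there; index)
open import Data.List.Relation.Unary.Any.Properties using (lookup-index)
open import Data.List.Relation.Unary.Unique.Propositional using (Unique)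
open import Data.List.Relation.Unary.Unique.Propositional.Properties using (filter⁺; allFin⁺)
open import Data.Product using (Σ; _×_; _,_; proj₁; proj₂)
open import Data.Empty using (⊥-elim)
open import Function.Bundles using (_↔_; mk↔ₛ′)
open import Function.Definitions using (Injective)
open import Function.Properties.Inverse using (↔-trans; ↔-sym)
open import Relation.Binary.PropositionalEquality
open import Level using (0ℓ)
open import Relation.Unary using (Pred; Decidable)

Unique-lookup-injective : ∀ {a} {A : Set a} {xs : List A} → Unique xs → Injective _≡_ _≡_ (lookup xs)
Unique-lookup-injective               (_ ∷ _)    {zero}  {zero}  _  = refl
Unique-lookup-injective {xs = _ ∷ xs} (x≢xs ∷ _) {zero}  {suc j} eq =
  ⊥-elim (All.lookup x≢xs (∈-lookup {xs = xs} j) eq)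
Unique-lookup-injective {xs = _ ∷ xs} (x≢xs ∷ _) {suc i} {zero}  eq =
  ⊥-elim (All.lookup x≢xs (∈-lookup {xs = xs} i) (sym eq))
Unique-lookup-injective               (_ ∷ u)    {suc i} {suc j} eq = cong suc (Unique-lookup-injective u eq)

record Enumeration {m : ℕ} (P : Pred (Fin m) 0ℓ) : Set where
  field
    size              : ℕ
    element           : Fin size → Fin m
    element-injective : Injective _≡_ _≡_ element
    element-satisfies : ∀ t → P (element t)
    index-of          : ∀ i → P i → Fin size
    element-index-of  : ∀ i (p : P i) → element (index-of i p) ≡ i

  index-of-unique : ∀ {i t} (p : P i) → element t ≡ i → index-of i p ≡ t
  index-of-unique {i} p eq = element-injective (trans (element-index-of i p) (sym eq))

enumerate : ∀ {m} {P : Pred (Fin m) 0ℓ} → Decidable P → Enumeration P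
enumerate {m} P? = record
  { size              = length xs
  ; element           = lookup xs
  ; element-injective = Unique-lookup-injective (filter⁺ P? (allFin⁺ m))
  ; element-satisfies = λ t → proj₂ (∈-filter⁻ P? {xs = allFin m} (∈-lookup {xs = xs} t))
  ; index-of          = λ i p → index (∈-filter⁺ P? (∈-allFin i) p)
  ; element-index-of  = λ i p → sym (lookup-index (∈-filter⁺ P? (∈-allFin i) p))
  }
  where
    xs : List (Fin m)
    xs = filter P? (allFin m)

module _ {n : ℕ} (gs : List (Fin n → Fin n)) where

  CommutesWith : (Fin n → Fin n) → Set
  CommutesWith f = ∀ {g} → g ∈ gs → ∀ x → f (g x) ≡ g (f x)

  Reach-trans : ∀ {x y z} → Reach gs x y → Reach gs y z → Reach gs x z
  Reach-trans p here        = p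
  Reach-trans p (step g∈ q) = step g∈ (Reach-trans p q)

  Reach-sym : (∀ {g} → g ∈ gs → ∀ x → g (g x) ≡ x) → ∀ {x y} → Reach gs x y → Reach gs y x
  Reach-sym involutive here = here
  Reach-sym involutive (step {g} {y} g∈ p) =
    Reach-trans (subst (Reach gs (g y)) (involutive g∈ y) (step g∈ here)) (Reach-sym involutive p)

  Reach-map : ∀ {f} → CommutesWith f → ∀ {x y} → Reach gs x y → Reach gs (f x) (f y)
  Reach-map comm here = here
  Reach-map {f} comm (step {g} {y} g∈ p) = subst (Reach gs (f _)) (sym (comm g∈ y)) (step g∈ (Reach-map comm p))

  Reach-agree : ∀ {f h} → CommutesWith f → CommutesWith h →
                ∀ {x y} → f x ≡ h x → Reach gs x y → f y ≡ h y
  Reach-agree _ _ fx≡hx here = fx≡hx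
  Reach-agree {f} {h} f-comm h-comm fx≡hx (step {g} {y} g∈ p) = begin
    f (g y) ≡⟨ f-comm g∈ y ⟩
    g (f y) ≡⟨ cong g (Reach-agree f-comm h-comm fx≡hx p) ⟩
    g (h y) ≡⟨ h-comm g∈ y ⟨
    h (g y) ∎
    where open ≡-Reasoning

module _ (M : Map) where
  open Map M

  fun-commutes : (α : Automorphism) → CommutesWith (r₀ ∷ r₁ ∷ r₂ ∷ []) (fun α)
  fun-commutes α (here refl)                 = comm₀ α
  fun-commutes α (there (here refl))         = comm₁ α
  fun-commutes α (there (there (here refl))) = comm₂ α

  -- Connectedness makes the action of Γ(M) on flags free.
  fun-unique : (α β : Automorphism) → ∀ {x} → fun α x ≡ fun β x → ∀ y → fun α y ≡ fun β y
  fun-unique α β eq y = Reach-agree _ (fun-commutes α) (fun-commutes β) eq (connected _ y)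

  SameVertex-trans : ∀ {x y z} → SameVertex x y → SameVertex y z → SameVertex x z
  SameVertex-trans = Reach-trans _

  SameVertex-sym : ∀ {x y} → SameVertex x y → SameVertex y x
  SameVertex-sym = Reach-sym _ involutive
    where
      involutive : ∀ {g} → g ∈ r₁ ∷ r₂ ∷ [] → ∀ x → g (g x) ≡ x
      involutive (here refl)         = r₁-inv
      involutive (there (here refl)) = r₂-inv

  SameVertex-map : (α : Automorphism) → ∀ {x y} → SameVertex x y → SameVertex (fun α x) (fun α y)
  SameVertex-map α = Reach-map _ commutes
    where
      commutes : CommutesWith (r₁ ∷ r₂ ∷ []) (fun α)
      commutes (here refl)         = comm₁ α
      commutes (there (here refl)) = comm₂ α

module FlagOrbits (M : Map) {k : ℕ} (orbits : Map.NumFlagOrbits M k) where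
  open Map M

  orbit : Fin n → Fin k
  orbit = proj₁ orbits

  orbit-surjective : ∀ j → Σ (Fin n) λ x → orbit x ≡ j
  orbit-surjective j = let x , orbit≡ = proj₁ (proj₂ orbits) j in x , orbit≡ refl

  orbit-fun : (α : Automorphism) → ∀ x → orbit (fun α x) ≡ orbit x
  orbit-fun α x = sym (proj₂ (proj₂ (proj₂ orbits) x (fun α x)) (α , refl))

  orbit≡⇒SameFlagOrbit : ∀ {x y} → orbit x ≡ orbit y → SameFlagOrbit x y
  orbit≡⇒SameFlagOrbit {x} {y} = proj₁ (proj₂ (proj₂ orbits) x y)

module FlagsAtVertex (M : Map) (transitive : Map.VertexTransitive M)
                     {k : ℕ} (orbits : Map.NumFlagOrbits M k)
                     {x₀ : Fin (Map.n M)} {m : ℕ} (flags : Map.VertexFlagCount M x₀ m) where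
  open Map M
  open FlagOrbits M orbits

  flag : Fin m → Fin n
  flag = proj₁ flags

  flag-at : ∀ i → SameVertex x₀ (flag i)
  flag-at = proj₂ (proj₂ (proj₂ flags))

  position : ∀ y → SameVertex x₀ y → Fin m
  position y p = proj₁ (proj₁ (proj₂ (proj₂ flags)) y p)

  flag-position : ∀ y p → flag (position y p) ≡ y
  flag-position y p = proj₂ (proj₁ (proj₂ (proj₂ flags)) y p)

  position-unique : ∀ {y i} p → flag i ≡ y → position y p ≡ i
  position-unique {y} p eq = proj₁ (proj₂ flags) (trans (flag-position y p) (sym eq))

  seed : Fin k → Fin n
  seed j = proj₁ (orbit-surjective j)

  mover : Fin k → Automorphism
  mover j = proj₁ (transitive (seed j) x₀)

  representative : Fin k → Fin n
  representative j = fun (mover j) (seed j)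

  representative-at : ∀ j → SameVertex x₀ (representative j)
  representative-at j = SameVertex-sym M (proj₂ (transitive (seed j) x₀))

  orbit-representative : ∀ j → orbit (representative j) ≡ j
  orbit-representative j = trans (orbit-fun (mover j) (seed j)) (proj₂ (orbit-surjective j))

  orbitAtVertex : Enumeration (λ i → orbit (flag i) ≡ orbit x₀)
  orbitAtVertex = enumerate (λ i → orbit (flag i) ≟ orbit x₀)

  open Enumeration orbitAtVertex

  stabiliser : Fin size → Automorphism
  stabiliser t = proj₁ (orbit≡⇒SameFlagOrbit (sym (element-satisfies t)))

  stabiliser-x₀ : ∀ t → fun (stabiliser t) x₀ ≡ flag (element t)
  stabiliser-x₀ t = proj₂ (orbit≡⇒SameFlagOrbit (sym (element-satisfies t)))

  stabiliser-at : ∀ t → SameVertex x₀ (fun (stabiliser t) x₀)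
  stabiliser-at t = subst (SameVertex x₀) (sym (stabiliser-x₀ t)) (flag-at (element t))

  stabiliserIndex : (α : Automorphism) → SameVertex x₀ (fun α x₀) → Fin size
  stabiliserIndex α p = index-of (position (fun α x₀) p) orbit≡
    where
      orbit≡ : orbit (flag (position (fun α x₀) p)) ≡ orbit x₀
      orbit≡ = trans (cong orbit (flag-position _ p)) (orbit-fun α x₀)

  stabiliserIndex-unique : ∀ α p {t} → fun α x₀ ≡ flag (element t) → stabiliserIndex α p ≡ t
  stabiliserIndex-unique α p eq = index-of-unique _ (sym (position-unique p (sym eq)))

  stabiliser-stabiliserIndex : ∀ α p → fun (stabiliser (stabiliserIndex α p)) x₀ ≡ fun α x₀
  stabiliser-stabiliserIndex α p = begin
    fun (stabiliser t) x₀ ≡⟨ stabiliser-x₀ t ⟩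
    flag (element t)      ≡⟨ cong flag (element-index-of _ _) ⟩
    flag (position _ p)   ≡⟨ flag-position _ p ⟩
    fun α x₀              ∎
    where
      open ≡-Reasoning
      t : Fin size
      t = stabiliserIndex α p

  transporter : Fin m → Automorphism
  transporter i = proj₁ (orbit≡⇒SameFlagOrbit (orbit-representative (orbit (flag i))))

  transporter-representative : ∀ i → fun (transporter i) (representative (orbit (flag i))) ≡ flag i
  transporter-representative i = proj₂ (orbit≡⇒SameFlagOrbit (orbit-representative (orbit (flag i))))

  transporter-at : ∀ i → SameVertex x₀ (fun (transporter i) x₀)
  transporter-at i = SameVertex-trans M
    (subst (SameVertex x₀) (sym (transporter-representative i)) (flag-at i))
    (SameVertex-map M (transporter i) (SameVertex-sym M (representative-at _)))

  split : Fin m → Fin k × Fin size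
  split i = orbit (flag i) , stabiliserIndex (transporter i) (transporter-at i)

  join : Fin k × Fin size → Fin m
  join (j , t) = position (fun (stabiliser t) (representative j))
    (SameVertex-trans M (stabiliser-at t) (SameVertex-map M (stabiliser t) (representative-at j)))

  transporter-unique : ∀ i α → fun α (representative (orbit (flag i))) ≡ flag i →
                       ∀ y → fun (transporter i) y ≡ fun α y
  transporter-unique i α eq = fun-unique M (transporter i) α (trans (transporter-representative i) (sym eq))

  join-split : ∀ i → join (split i) ≡ i
  join-split i = position-unique _ (sym (begin
    fun σ (representative j)  ≡⟨ fun-unique M σ α (stabiliser-stabiliserIndex α (transporter-at i)) _ ⟩
    fun α (representative j)  ≡⟨ transporter-representative i ⟩
    flag i                    ∎))
    where
      open ≡-Reasoning
      j : Fin k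
      j = orbit (flag i)
      α σ : Automorphism
      α = transporter i
      σ = stabiliser (stabiliserIndex α (transporter-at i))

  split-join : ∀ jt → split (join jt) ≡ jt
  split-join (j , t) = cong₂ _,_ orbit≡ (stabiliserIndex-unique α (transporter-at i) α-x₀)
    where
      open ≡-Reasoning
      i : Fin m
      i = join (j , t)
      α σ : Automorphism
      α = transporter i
      σ = stabiliser t
      σ-representative : fun σ (representative j) ≡ flag i
      σ-representative = sym (flag-position _ _)
      orbit≡ : orbit (flag i) ≡ j
      orbit≡ = begin
        orbit (flag i)                   ≡⟨ cong orbit σ-representative ⟨
        orbit (fun σ (representative j)) ≡⟨ orbit-fun σ _ ⟩
        orbit (representative j)         ≡⟨ orbit-representative j ⟩
        j                                ∎
      σ-representative′ : fun σ (representative (orbit (flag i))) ≡ flag i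
      σ-representative′ = subst (λ j′ → fun σ (representative j′) ≡ flag i) (sym orbit≡) σ-representative
      α-x₀ : fun α x₀ ≡ flag (element t)
      α-x₀ = begin
        fun α x₀         ≡⟨ transporter-unique i σ σ-representative′ x₀ ⟩
        fun σ x₀         ≡⟨ stabiliser-x₀ t ⟩
        flag (element t) ∎

  flags↔orbits×stabiliser : Fin m ↔ (Fin k × Fin size)
  flags↔orbits×stabiliser = mk↔ₛ′ split join split-join join-split

  orbitCount∣flagCount : k ∣ m
  orbitCount∣flagCount = divides size (trans m≡k*size (*-comm k size))
    where
      m≡k*size : m ≡ k * size
      m≡k*size = ↔⇒≡ (↔-trans flags↔orbits×stabiliser (↔-sym *↔×))

mainTheorem1 : (M : Map) (q k : ℕ) → Map.VertexTransitive M → Map.AllDegrees M q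
    → Map.NumFlagOrbits M k → k ∣ 2 * q
mainTheorem1 M q k transitive degrees orbits =
  FlagsAtVertex.orbitCount∣flagCount M transitive orbits (degrees (Map.someFlag M))
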